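{- Let ${\cal F}$ be a Fano plane, $\epsilon$ a composition factor on ${\cal F}$, $g\in\mathrm{Aut}({\cal F})$, and let $\{P,Q,R,S\}$ be a quadrilateral in ${\cal F}$. Then $$\delta^\ast(g,P\wedge Q)\,\delta^\ast(g,Q\wedge R)=\delta^\ast(g,P\wedge S)\,\delta^\ast(g,S\wedge R).$$
   Context: ${\cal F}$ is a Fano plane (seven points, seven lines), $\mathrm{Aut}({\cal F})$ the group of bijections sending lines to lines; for distinct points $P,Q$, $P\wedge Q$ is the line through them and $P+Q$ the third point on it. A quadrilateral is a set of four points no three of which are collinear (equivalently, the complement of a line). $\mathbb F$ is a field of characteristic not 2, $\mathbb O_{\cal F}$ has basis $1,e_P$. A multiplication factor $\epsilon$ assigns $\epsilon_{PQ}\in\{\pm1\}$ to distinct $P,Q$ with $\epsilon_{QP}=-\epsilon_{PQ}$, defining the product with unit $1$, $e_Pe_Q=\epsilon_{PQ}e_{P+Q}$, $e_P^2=-1$; it is a composition factor if $N(\lambda^01+\sum\lambda^Pe_P)=(\lambda^0)^2+\sum(\lambda^P)^2$ is multiplicative. For a line $D$, $\delta^\ast(g,D)=\epsilon_{AB}\epsilon_{g(A)g(B)}$ for any distinct $A,B\in D$ (independent of the choice). -}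

module Defs where

open import Level using (Level; _⊔_)
open import Data.Bool using (Bool; true; false; _∧_; _∨_; not; T)
open import Data.Fin using (Fin)
open import Data.Fin.Properties using (_≟_)
open import Data.Product using (Σ; ∃; ∃-syntax; _×_; _,_)
open import Data.Sum using (_⊎_)
open import Data.Sign using (Sign) renaming (_*_ to _*ˢ_)
import Data.Sign as Sign
import Data.Vec.Functional as VF
open import Relation.Nullary using (¬_)
open import Relation.Nullary.Decidable using (⌊_⌋)
open import Relation.Binary.PropositionalEquality using (_≡_; _≢_)
open import Function.Definitions using (Bijective)
open import Algebra.Bundles using (CommutativeRing)

Point : Set
Point = Fin 7

Line : Set
Line = Fin 7

record FanoPlane : Set where
  field
    inc : Point → Line → Bool

  _∈ₗ_ : Point → Line → Set
  P ∈ₗ L = T (inc P L)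

  field
    two-points   : ∀ P Q → P ≢ Q → Σ Line λ L → (P ∈ₗ L × Q ∈ₗ L) ×
                     (∀ L' → P ∈ₗ L' → Q ∈ₗ L' → L' ≡ L)
    two-lines    : ∀ L M → L ≢ M → Σ Point λ P → (P ∈ₗ L × P ∈ₗ M) ×
                     (∀ P' → P' ∈ₗ L → P' ∈ₗ M → P' ≡ P)
    three-points : ∀ L → Σ Point λ A → Σ Point λ B → Σ Point λ C →
                     A ≢ B × A ≢ C × B ≢ C × A ∈ₗ L × B ∈ₗ L × C ∈ₗ L ×
                     (∀ X → X ∈ₗ L → X ≡ A ⊎ X ≡ B ⊎ X ≡ C)

  collinearᵇ : Point → Point → Point → Bool
  collinearᵇ P Q R = VF.foldr _∨_ false (λ L → inc P L ∧ inc Q L ∧ inc R L)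

  Collinear : Point → Point → Point → Set
  Collinear P Q R = Σ Line λ L → P ∈ₗ L × Q ∈ₗ L × R ∈ₗ L

  -- R = P + Q : P, Q, R pairwise distinct and collinear
  -- (for distinct P, Q, P + Q is the third point on the line P ∧ Q)
  isSumᵇ : Point → Point → Point → Bool
  isSumᵇ P Q R = not ⌊ P ≟ Q ⌋ ∧ not ⌊ R ≟ P ⌋ ∧ not ⌊ R ≟ Q ⌋ ∧ collinearᵇ P Q R

  Quadrilateral : Point → Point → Point → Point → Set
  Quadrilateral P Q R S =
    (P ≢ Q × P ≢ R × P ≢ S × Q ≢ R × Q ≢ S × R ≢ S) ×
    ¬ Collinear P Q R × ¬ Collinear P Q S × ¬ Collinear P R S × ¬ Collinear Q R S

  IsAut : (Point → Point) → Set
  IsAut g = Bijective _≡_ _≡_ g ×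
            (∀ L → Σ Line λ L' →
               (∀ P → P ∈ₗ L → g P ∈ₗ L') ×
               (∀ X → X ∈ₗ L' → Σ Point λ P → P ∈ₗ L × g P ≡ X))

record MultFactor (𝓕 : FanoPlane) : Set where
  field
    ε      : Point → Point → Sign
    ε-anti : ∀ P Q → P ≢ Q → ε Q P ≡ Sign.opposite (ε P Q)

record IsFieldCharNot2 {c ℓ : Level} (K : CommutativeRing c ℓ) : Set (c ⊔ ℓ) where
  open CommutativeRing K
  field
    1≉0     : ¬ (1# ≈ 0#)
    inverse : ∀ x → ¬ (x ≈ 0#) → Σ Carrier λ y → x * y ≈ 1#
    char≢2  : ¬ (1# + 1# ≈ 0#)

-- The algebra O_F over a commutative ring K: elements λ⁰ 1 + Σ λᴾ eᴾ

module Octonions {c ℓ : Level} (K : CommutativeRing c ℓ)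
                 (𝓕 : FanoPlane) (mf : MultFactor 𝓕) where
  open CommutativeRing K
  open FanoPlane 𝓕
  open MultFactor mf

  record Oct : Set c where
    constructor oct
    field
      re : Carrier
      im : Point → Carrier

  sign : Sign → Carrier
  sign Sign.+ = 1#
  sign Sign.- = - 1#

  Σ₇ : (Point → Carrier) → Carrier
  Σ₇ f = VF.foldr _+_ 0# f

  whenᵇ : Bool → Carrier → Carrier
  whenᵇ true  x = x
  whenᵇ false x = 0#

  -- product with unit 1, e_P e_Q = ε_PQ e_{P+Q} (P ≠ Q), e_P² = -1
  _·_ : Oct → Oct → Oct
  oct a₀ a · oct b₀ b = oct
    (a₀ * b₀ - Σ₇ (λ P → a P * b P))
    (λ R → a₀ * b R + a R * b₀ +
           Σ₇ (λ P → Σ₇ (λ Q →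
              whenᵇ (isSumᵇ P Q R) (sign (ε P Q) * (a P * b Q)))))

  N : Oct → Carrier
  N (oct a₀ a) = a₀ * a₀ + Σ₇ (λ P → a P * a P)

  IsCompositionFactor : Set (c ⊔ ℓ)
  IsCompositionFactor = ∀ x y → N (x · y) ≈ N x * N y

-- δ*(g, A ∧ B) = ε_AB ε_{g(A) g(B)}, computed from distinct points A, B of
-- the line (the paper notes this is independent of the choice).

δ* : {𝓕 : FanoPlane} → MultFactor 𝓕 → (Point → Point) → Point → Point → Sign
δ* ε g A B = MultFactor.ε ε A B *ˢ MultFactor.ε ε (g A) (g B)

{-# OPTIONS --safe #-}
module Submission where

-- The quadrilateral P Q R S has two distinct diagonal points T = P + Q = R + S and
-- U = P + S = R + Q, so that
--   (e_P + e_R)(e_Q + e_S) = (ε_PQ + ε_RS) e_T + (ε_PS + ε_RQ) e_U.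
-- Both factors have norm 2, so multiplicativity of N gives
-- (ε_PQ + ε_RS)² + (ε_PS + ε_RQ)² = 4.  Each square is 0 or 4, and 4 ≠ 0 in characteristic
-- not 2, hence exactly one of them vanishes: ε_PQ ε_RS = -ε_PS ε_RQ, which by antisymmetry
-- reads ε_PQ ε_QR = -ε_PS ε_SR.  Automorphisms map quadrilaterals to quadrilaterals, so the
-- same relation holds for g(P) g(Q) g(R) g(S), and multiplying the two relations gives the
-- identity for δ*.

open import Defs
open import Level using (Level)
open import Algebra.Bundles using (CommutativeRing; CommutativeMonoid)
open import Data.Bool using (Bool; true; false; T; _∧_; _∨_; not; if_then_else_)
open import Data.Bool.Properties using (T-∧; T-∨; T-≡; ⇔→≡)
open import Data.Fin using (Fin; zero; suc)
open import Data.Fin.Properties using (_≟_; punchInᵢ≢i)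
open import Data.Nat using (ℕ)
open import Data.Product using (Σ; ∃; _×_; _,_; proj₁)
open import Data.Product.Function.NonDependent.Propositional using (_×-⇔_)
open import Data.Sign using (Sign; opposite) renaming (_*_ to _*ˢ_)
import Data.Sign as Sign
open import Data.Sign.Properties using (*-commutativeSemigroup)
open import Algebra.Properties.CommutativeSemigroup *-commutativeSemigroup using (interchange)
open import Data.Sum using (_⊎_; inj₁; inj₂; [_,_]′)
import Data.Sum as Sum
open import Data.Vec.Functional using (Vector; foldr; removeAt)
open import Function using (_∘_; _∘₂_; _⇔_; mk⇔; Equivalence)
open import Function.Construct.Composition using (_⇔-∘_)
open import Function.Construct.Identity using (⇔-id)
open import Function.Construct.Symmetry using (⇔-sym)
open import Relation.Binary.PropositionalEquality using (_≡_; _≢_; ≢-sym)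
import Relation.Binary.PropositionalEquality as ≡
open import Relation.Nullary using (¬_; Dec; yes; no; contradiction)
open import Relation.Nullary.Decidable using (⌊_⌋; toWitness; fromWitness; toWitnessFalse; fromWitnessFalse)

T-foldr-∨ : ∀ {n} (f : Fin n → Bool) → T (foldr _∨_ false f) ⇔ ∃ λ i → T (f i)
T-foldr-∨ f = mk⇔ (to f) (λ (i , fi) → from f i fi)
  where
  to : ∀ {n} (f : Fin n → Bool) → T (foldr _∨_ false f) → ∃ λ i → T (f i)
  to {ℕ.suc _} f t with Equivalence.to T-∨ t
  ... | inj₁ f₀ = zero , f₀
  ... | inj₂ rest with to (f ∘ suc) rest
  ...   | i , fi = suc i , fi
  from : ∀ {n} (f : Fin n → Bool) i → T (f i) → T (foldr _∨_ false f)
  from f zero    fi = Equivalence.from T-∨ (inj₁ fi)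
  from f (suc i) fi = Equivalence.from T-∨ (inj₂ (from (f ∘ suc) i fi))

T-∧₃ : ∀ {a b c} → T (a ∧ b ∧ c) ⇔ (T a × T b × T c)
T-∧₃ = (⇔-id _ ×-⇔ T-∧) ⇔-∘ T-∧

T-∧₄ : ∀ {a b c d} → T (a ∧ b ∧ c ∧ d) ⇔ (T a × T b × T c × T d)
T-∧₄ = (⇔-id _ ×-⇔ T-∧₃) ⇔-∘ T-∧

T-not-⌊⌋ : ∀ {A : Set} {a? : Dec A} → T (not ⌊ a? ⌋) ⇔ (¬ A)
T-not-⌊⌋ = mk⇔ toWitnessFalse fromWitnessFalse

-- Hypothesis and conclusion both say a b c d = -.
swap-opposite-factors : ∀ a b c d → a *ˢ opposite d ≡ opposite (c *ˢ opposite b) →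
                        a *ˢ b ≡ opposite (c *ˢ d)
swap-opposite-factors Sign.+ Sign.+ Sign.+ Sign.+ ()
swap-opposite-factors Sign.+ Sign.+ Sign.+ Sign.- _ = ≡.refl
swap-opposite-factors Sign.+ Sign.+ Sign.- Sign.+ _ = ≡.refl
swap-opposite-factors Sign.+ Sign.+ Sign.- Sign.- ()
swap-opposite-factors Sign.+ Sign.- Sign.+ Sign.+ _ = ≡.refl
swap-opposite-factors Sign.+ Sign.- Sign.+ Sign.- ()
swap-opposite-factors Sign.+ Sign.- Sign.- Sign.+ ()
swap-opposite-factors Sign.+ Sign.- Sign.- Sign.- _ = ≡.refl
swap-opposite-factors Sign.- Sign.+ Sign.+ Sign.+ _ = ≡.refl
swap-opposite-factors Sign.- Sign.+ Sign.+ Sign.- ()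
swap-opposite-factors Sign.- Sign.+ Sign.- Sign.+ ()
swap-opposite-factors Sign.- Sign.+ Sign.- Sign.- _ = ≡.refl
swap-opposite-factors Sign.- Sign.- Sign.+ Sign.+ ()
swap-opposite-factors Sign.- Sign.- Sign.+ Sign.- _ = ≡.refl
swap-opposite-factors Sign.- Sign.- Sign.- Sign.+ _ = ≡.refl
swap-opposite-factors Sign.- Sign.- Sign.- Sign.- ()

module FanoGeometry (𝓕 : FanoPlane) where
  open FanoPlane 𝓕
  open ≡ using (refl; sym; trans)

  IsSum : Point → Point → Point → Set
  IsSum P Q R = P ≢ Q × R ≢ P × R ≢ Q × Collinear P Q R

  PointsOf : Line → Point → Point → Point → Set
  PointsOf L A B C = A ≢ B × A ≢ C × B ≢ C × A ∈ₗ L × B ∈ₗ L × C ∈ₗ L ×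
                     (∀ X → X ∈ₗ L → X ≡ A ⊎ X ≡ B ⊎ X ≡ C)

  T-collinearᵇ : ∀ {P Q R} → T (collinearᵇ P Q R) ⇔ Collinear P Q R
  T-collinearᵇ {P} {Q} {R} = mk⇔
    (λ t → let L , pqr = Equivalence.to some-line t in L , Equivalence.to T-∧₃ pqr)
    (λ (L , pqr) → Equivalence.from some-line (L , Equivalence.from T-∧₃ pqr))
    where
    some-line : T (collinearᵇ P Q R) ⇔ ∃ λ L → T (inc P L ∧ inc Q L ∧ inc R L)
    some-line = T-foldr-∨ (λ L → inc P L ∧ inc Q L ∧ inc R L)

  T-isSumᵇ : ∀ {P Q R} → T (isSumᵇ P Q R) ⇔ IsSum P Q R
  T-isSumᵇ {P} {Q} {R} =
    (T-not-⌊⌋ {a? = P ≟ Q} ×-⇔ T-not-⌊⌋ {a? = R ≟ P} ×-⇔ T-not-⌊⌋ {a? = R ≟ Q} ×-⇔ T-collinearᵇ)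
    ⇔-∘ T-∧₄

  line-unique : ∀ {P Q L M} → P ≢ Q → P ∈ₗ L → Q ∈ₗ L → P ∈ₗ M → Q ∈ₗ M → L ≡ M
  line-unique {P} {Q} {L} {M} P≢Q p q p′ q′ =
    let _ , _ , unique = two-points P Q P≢Q in trans (unique L p q) (sym (unique M p′ q′))

  pointsOf-swap₁₂ : ∀ {L A B C} → PointsOf L A B C → PointsOf L B A C
  pointsOf-swap₁₂ (A≢B , A≢C , B≢C , a , b , c , cover) =
    ≢-sym A≢B , B≢C , A≢C , b , a , c , [ inj₂ ∘ inj₁ , [ inj₁ , inj₂ ∘ inj₂ ]′ ]′ ∘₂ cover

  pointsOf-swap₂₃ : ∀ {L A B C} → PointsOf L A B C → PointsOf L A C B
  pointsOf-swap₂₃ (A≢B , A≢C , B≢C , a , b , c , cover) =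
    A≢C , A≢B , ≢-sym B≢C , a , c , b , Sum.map₂ Sum.swap ∘₂ cover

  pointsOf-from : ∀ {L A B C X} → PointsOf L A B C → X ∈ₗ L →
                  Σ Point λ B′ → Σ Point (PointsOf L X B′)
  pointsOf-from pts@(_ , _ , _ , _ , _ , _ , cover) x with cover _ x
  ... | inj₁ refl        = _ , _ , pts
  ... | inj₂ (inj₁ refl) = _ , _ , pointsOf-swap₁₂ pts
  ... | inj₂ (inj₂ refl) = _ , _ , pointsOf-swap₁₂ (pointsOf-swap₂₃ pts)

  pointsOf-through : ∀ {L X Y} → X ∈ₗ L → Y ∈ₗ L → X ≢ Y → Σ Point (PointsOf L X Y)
  pointsOf-through {L} x y X≢Y with three-points L
  ... | _ , _ , _ , pts with pointsOf-from pts x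
  ...   | B , C , pts′@(_ , _ , _ , _ , _ , _ , cover) with cover _ y
  ...     | inj₁ refl        = contradiction refl X≢Y
  ...     | inj₂ (inj₁ refl) = C , pts′
  ...     | inj₂ (inj₂ refl) = B , pointsOf-swap₂₃ pts′

  pointsOf-third : ∀ {L A B C X} → PointsOf L A B C → X ∈ₗ L → X ≢ A → X ≢ B → X ≡ C
  pointsOf-third (_ , _ , _ , _ , _ , _ , cover) x X≢A X≢B with cover _ x
  ... | inj₁ X≡A        = contradiction X≡A X≢A
  ... | inj₂ (inj₁ X≡B) = contradiction X≡B X≢B
  ... | inj₂ (inj₂ X≡C) = X≡C

  sum-exists : ∀ {P Q} → P ≢ Q → Σ Point (IsSum P Q)
  sum-exists {P} {Q} P≢Q with two-points P Q P≢Q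
  ... | L , (p , q) , _ with pointsOf-through p q P≢Q
  ...   | R , (_ , P≢R , Q≢R , _ , _ , r , _) = R , P≢Q , ≢-sym P≢R , ≢-sym Q≢R , L , p , q , r

  sum-unique : ∀ {P Q R R′} → IsSum P Q R → IsSum P Q R′ → R ≡ R′
  sum-unique (P≢Q , R≢P , R≢Q , _ , p , q , r) (_ , R′≢P , R′≢Q , _ , p′ , q′ , r′)
    with line-unique P≢Q p′ q′ p q
  ... | refl with pointsOf-through p q P≢Q
  ...   | _ , pts = trans (pointsOf-third pts r R≢P R≢Q) (sym (pointsOf-third pts r′ R′≢P R′≢Q))

  isSumᵇ≡≟ : ∀ {P Q R} → IsSum P Q R → ∀ X → isSumᵇ P Q X ≡ ⌊ X ≟ R ⌋
  isSumᵇ≡≟ {P} {Q} {R} R-sum X =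
    ⇔→≡ (T-≡ ⇔-∘ (≡⇔True ⇔-∘ (IsSum⇔≡ ⇔-∘ (T-isSumᵇ ⇔-∘ ⇔-sym T-≡))))
    where
    IsSum⇔≡ : IsSum P Q X ⇔ (X ≡ R)
    IsSum⇔≡ = mk⇔ (λ X-sum → sum-unique X-sum R-sum) (λ { refl → R-sum })
    ≡⇔True : (X ≡ R) ⇔ T ⌊ X ≟ R ⌋
    ≡⇔True = mk⇔ fromWitness toWitness

  collinear-swap₂₃ : ∀ {P Q R} → Collinear P Q R → Collinear P R Q
  collinear-swap₂₃ (L , p , q , r) = L , p , r , q

  collinear-swap₁₃ : ∀ {P Q R} → Collinear P Q R → Collinear R Q P
  collinear-swap₁₃ (L , p , q , r) = L , r , q , p

  quadrilateral-swap₂₄ : ∀ {P Q R S} → Quadrilateral P Q R S → Quadrilateral P S R Q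
  quadrilateral-swap₂₄ ((P≢Q , P≢R , P≢S , Q≢R , Q≢S , R≢S) , ¬PQR , ¬PQS , ¬PRS , ¬QRS) =
    (P≢S , P≢R , P≢Q , ≢-sym R≢S , ≢-sym Q≢S , ≢-sym Q≢R) ,
    ¬PRS ∘ collinear-swap₂₃ , ¬PQS ∘ collinear-swap₂₃ ,
    ¬PQR ∘ collinear-swap₂₃ , ¬QRS ∘ collinear-swap₁₃

  -- The line R ∧ S meets P ∧ Q in a point other than P and Q, that is, in P + Q.
  quadrilateral-diagonal : ∀ {P Q R S T} → Quadrilateral P Q R S → IsSum P Q T → IsSum R S T
  quadrilateral-diagonal ((_ , _ , _ , _ , _ , R≢S) , ¬PQR , ¬PQS , ¬PRS , ¬QRS)
                         T-sum@(P≢Q , _ , _ , L , p , q , t)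
    with two-points _ _ R≢S
  ... | M , (r , s) , _ with two-lines L M (λ { refl → ¬PQR (L , p , q , r) })
  ...   | X , (xL , xM) , _ with sum-unique (P≢Q , X≢P , X≢Q , L , p , q , xL) T-sum
    where
    X≢P = λ { refl → ¬PRS (M , xM , r , s) }
    X≢Q = λ { refl → ¬QRS (M , xM , r , s) }
  ...     | refl = R≢S , (λ { refl → ¬PQR (L , p , q , t) }) , (λ { refl → ¬PQS (L , p , q , t) }) ,
                   M , r , s , xM

  quadrilateral-diagonals-distinct : ∀ {P Q R S T U} → Quadrilateral P Q R S →
                                     IsSum P Q T → IsSum P S U → T ≢ U
  quadrilateral-diagonals-distinct (_ , _ , ¬PQS , _) (_ , T≢P , _ , L , p , q , t)
                                   (_ , _ , _ , _ , p′ , s , u) refl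
    with line-unique (≢-sym T≢P) p t p′ u
  ... | refl = ¬PQS (L , p , q , s)

  quadrilateral-diagonal-points : ∀ {P Q R S} → Quadrilateral P Q R S →
    Σ Point λ T → Σ Point λ U → (IsSum P Q T × IsSum R S T) × (IsSum P S U × IsSum R Q U) × T ≢ U
  quadrilateral-diagonal-points quad@((P≢Q , _ , P≢S , _) , _)
    with sum-exists P≢Q | sum-exists P≢S
  ... | T , T-sum | U , U-sum =
    T , U , (T-sum , quadrilateral-diagonal quad T-sum) ,
    (U-sum , quadrilateral-diagonal (quadrilateral-swap₂₄ quad) U-sum) ,
    quadrilateral-diagonals-distinct quad T-sum U-sum

  aut-reflects-collinear : ∀ {g P Q R} → IsAut g → P ≢ Q →
                           Collinear (g P) (g Q) (g R) → Collinear P Q R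
  aut-reflects-collinear {g} {P} {Q} {R} ((g-inj , _) , g-lines) P≢Q (_ , gp , gq , gr)
    with two-points P Q P≢Q
  ... | L , (p , q) , _ with g-lines L
  ...   | _ , into , onto with line-unique (P≢Q ∘ g-inj) gp gq (into P p) (into Q q)
  ...     | refl with onto (g R) gr
  ...       | R′ , r′ , gR′≡gR with g-inj gR′≡gR
  ...         | refl = L , p , q , r′

  aut-preserves-quadrilateral : ∀ {g P Q R S} → IsAut g → Quadrilateral P Q R S →
                                Quadrilateral (g P) (g Q) (g R) (g S)
  aut-preserves-quadrilateral g-aut@((g-inj , _) , _)
    ((P≢Q , P≢R , P≢S , Q≢R , Q≢S , R≢S) , ¬PQR , ¬PQS , ¬PRS , ¬QRS) =
    (P≢Q ∘ g-inj , P≢R ∘ g-inj , P≢S ∘ g-inj , Q≢R ∘ g-inj , Q≢S ∘ g-inj , R≢S ∘ g-inj) ,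
    ¬PQR ∘ aut-reflects-collinear g-aut P≢Q , ¬PQS ∘ aut-reflects-collinear g-aut P≢Q ,
    ¬PRS ∘ aut-reflects-collinear g-aut P≢R , ¬QRS ∘ aut-reflects-collinear g-aut Q≢R

module SumProperties {a ℓ} (M : CommutativeMonoid a ℓ) where
  open CommutativeMonoid M renaming (ε to 0#; _∙_ to _+_; ∙-congˡ to +-congˡ; identityʳ to +-identityʳ)
  open import Algebra.Properties.CommutativeMonoid.Sum M using (sum; sum-remove; sum-cong-≋; sum-replicate-zero)
  open import Relation.Binary.Reasoning.Setoid setoid

  sum-single : ∀ {n} (t : Vector Carrier (ℕ.suc n)) j → (∀ i → i ≢ j → t i ≈ 0#) → sum t ≈ t j
  sum-single {n} t j vanishes = begin
    sum t                    ≈⟨ sum-remove {i = j} t ⟩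
    t j + sum (removeAt t j) ≈⟨ +-congˡ (trans (sum-cong-≋ (λ i → vanishes _ (punchInᵢ≢i j i)))
                                                (sum-replicate-zero n)) ⟩
    t j + 0#                 ≈⟨ +-identityʳ (t j) ⟩
    t j                      ∎

module KroneckerDelta {c ℓ} (K : CommutativeRing c ℓ) where
  open CommutativeRing K
  open import Algebra.Properties.Semiring.Sum semiring using (sum; sum-cong-≋; ∑-distrib-+; *-distribˡ-sum)
  open SumProperties +-commutativeMonoid using (sum-single)
  open import Algebra.Solver.Ring.NaturalCoefficients.Default commutativeSemiring using (solve; _:+_; _:*_; _:=_)
  open import Relation.Binary.Reasoning.Setoid setoid

  δ : ∀ {n} → Fin n → Fin n → Carrier
  δ i j = if ⌊ j ≟ i ⌋ then 1# else 0#

  δ-diag : ∀ {n} (i : Fin n) → δ i i ≈ 1#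
  δ-diag i with i ≟ i
  ... | yes _   = refl
  ... | no i≢i = contradiction ≡.refl i≢i

  δ-off : ∀ {n} {i j : Fin n} → j ≢ i → δ i j ≈ 0#
  δ-off {i = i} {j} j≢i with j ≟ i
  ... | yes j≡i = contradiction j≡i j≢i
  ... | no _    = refl

  sum-δ : ∀ {n} (i : Fin n) (f : Vector Carrier n) → sum (λ j → δ i j * f j) ≈ f i
  sum-δ {ℕ.suc _} i f = begin
    sum (λ j → δ i j * f j) ≈⟨ sum-single _ i (λ j j≢i → trans (*-congʳ (δ-off j≢i)) (zeroˡ (f j))) ⟩
    δ i i * f i             ≈⟨ trans (*-congʳ (δ-diag i)) (*-identityˡ (f i)) ⟩
    f i                     ∎

  twoPoint : ∀ {n} → Carrier → Fin n → Carrier → Fin n → Vector Carrier n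
  twoPoint α i β j k = α * δ i k + β * δ j k

  twoPoint-at₁ : ∀ {n α β} {i j : Fin n} → i ≢ j → twoPoint α i β j i ≈ α
  twoPoint-at₁ {α = α} {β} {i} {j} i≢j = begin
    α * δ i i + β * δ j i ≈⟨ +-cong (*-congˡ (δ-diag i)) (*-congˡ (δ-off i≢j)) ⟩
    α * 1# + β * 0#       ≈⟨ +-cong (*-identityʳ α) (zeroʳ β) ⟩
    α + 0#                ≈⟨ +-identityʳ α ⟩
    α                     ∎

  twoPoint-at₂ : ∀ {n α β} {i j : Fin n} → i ≢ j → twoPoint α i β j j ≈ β
  twoPoint-at₂ {α = α} {β} {i} {j} i≢j = begin
    α * δ i j + β * δ j j ≈⟨ +-cong (*-congˡ (δ-off (≢-sym i≢j))) (*-congˡ (δ-diag j)) ⟩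
    α * 0# + β * 1#       ≈⟨ +-cong (zeroʳ α) (*-identityʳ β) ⟩
    0# + β                ≈⟨ +-identityˡ β ⟩
    β                     ∎

  twoPoint-off : ∀ {n α β} {i j k : Fin n} → k ≢ i → k ≢ j → twoPoint α i β j k ≈ 0#
  twoPoint-off {α = α} {β} {i} {j} {k} k≢i k≢j = begin
    α * δ i k + β * δ j k ≈⟨ +-cong (*-congˡ (δ-off k≢i)) (*-congˡ (δ-off k≢j)) ⟩
    α * 0# + β * 0#       ≈⟨ +-cong (zeroʳ α) (zeroʳ β) ⟩
    0# + 0#               ≈⟨ +-identityʳ 0# ⟩
    0#                    ∎

  sum-twoPoint : ∀ {n} α (i : Fin n) β j (f : Vector Carrier n) →
                 sum (λ k → twoPoint α i β j k * f k) ≈ α * f i + β * f j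
  sum-twoPoint α i β j f = begin
    sum (λ k → (α * δ i k + β * δ j k) * f k)
      ≈⟨ sum-cong-≋ (λ k → distribute α β (δ i k) (δ j k) (f k)) ⟩
    sum (λ k → α * (δ i k * f k) + β * (δ j k * f k))
      ≈⟨ ∑-distrib-+ (λ k → α * (δ i k * f k)) (λ k → β * (δ j k * f k)) ⟩
    sum (λ k → α * (δ i k * f k)) + sum (λ k → β * (δ j k * f k))
      ≈⟨ +-cong (sym (*-distribˡ-sum α (λ k → δ i k * f k)))
                (sym (*-distribˡ-sum β (λ k → δ j k * f k))) ⟩
    α * sum (λ k → δ i k * f k) + β * sum (λ k → δ j k * f k)
      ≈⟨ +-cong (*-congˡ (sum-δ i f)) (*-congˡ (sum-δ j f)) ⟩
    α * f i + β * f j ∎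
    where
    distribute : ∀ α β x y z → (α * x + β * y) * z ≈ α * (x * z) + β * (y * z)
    distribute = solve 5 (λ α β x y z → (α :* x :+ β :* y) :* z := α :* (x :* z) :+ β :* (y :* z)) refl

module FieldProperties {c ℓ} (K : CommutativeRing c ℓ) (isField : IsFieldCharNot2 K) where
  open CommutativeRing K
  open IsFieldCharNot2 isField
  open import Algebra.Solver.Ring.NaturalCoefficients.Default commutativeSemiring using (solve; _:*_; _:=_)
  open import Relation.Binary.Reasoning.Setoid setoid

  x≉0∧y≉0⇒x*y≉0 : ∀ {x y} → ¬ x ≈ 0# → ¬ y ≈ 0# → ¬ x * y ≈ 0#
  x≉0∧y≉0⇒x*y≉0 {x} {y} x≉0 y≉0 xy≈0 with inverse x x≉0
  ... | x⁻¹ , xx⁻¹≈1 = y≉0 (begin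
    y             ≈⟨ sym (*-identityˡ y) ⟩
    1# * y        ≈⟨ *-congʳ (sym xx⁻¹≈1) ⟩
    x * x⁻¹ * y   ≈⟨ solve 3 (λ x x⁻¹ y → x :* x⁻¹ :* y := x⁻¹ :* (x :* y)) refl x x⁻¹ y ⟩
    x⁻¹ * (x * y) ≈⟨ *-congˡ xy≈0 ⟩
    x⁻¹ * 0#      ≈⟨ zeroʳ x⁻¹ ⟩
    0#            ∎)

  [1+1]*[1+1]≉0 : ¬ (1# + 1#) * (1# + 1#) ≈ 0#
  [1+1]*[1+1]≉0 = x≉0∧y≉0⇒x*y≉0 char≢2 char≢2

module OctonionNorms {c ℓ} (K : CommutativeRing c ℓ) (𝓕 : FanoPlane) (mf : MultFactor 𝓕) where
  open CommutativeRing K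
  open Octonions K 𝓕 mf
  open FanoPlane 𝓕 using (isSumᵇ; Quadrilateral)
  open FanoGeometry 𝓕
  open MultFactor mf
  open KroneckerDelta K
  open import Algebra.Properties.Semiring.Sum semiring using (sum-cong-≋; *-distribˡ-sum)
  open import Algebra.Properties.Ring ring
    using (-0#≈0#; -‿+-comm; -‿distribˡ-*; -‿distribʳ-*; -‿involutive; x+x≈x⇒x≈0)
  open import Algebra.Solver.Ring.NaturalCoefficients.Default commutativeSemiring
    using (solve; _:+_; _:*_; _:=_; con)
  open import Relation.Binary.Reasoning.Setoid setoid

  pure : (Point → Carrier) → Oct
  pure = oct 0#

  e+e : Point → Point → Oct
  e+e A B = pure (twoPoint 1# A 1# B)

  norm-twoPoint : ∀ {z α A β B} → A ≢ B → Oct.re z ≈ 0# → (∀ X → Oct.im z X ≈ twoPoint α A β B X) →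
                  N z ≈ α * α + β * β
  norm-twoPoint {oct z₀ z} {α} {A} {β} {B} A≢B z₀≈0 z≈ = begin
    z₀ * z₀ + Σ₇ (λ X → z X * z X)
      ≈⟨ +-cong (trans (*-congʳ z₀≈0) (zeroˡ z₀)) (sum-cong-≋ (λ X → *-cong (z≈ X) (refl {z X}))) ⟩
    0# + Σ₇ (λ X → twoPoint α A β B X * z X)
      ≈⟨ +-identityˡ _ ⟩
    Σ₇ (λ X → twoPoint α A β B X * z X)
      ≈⟨ sum-twoPoint α A β B z ⟩
    α * z A + β * z B
      ≈⟨ +-cong (*-congˡ (trans (z≈ A) (twoPoint-at₁ A≢B)))
                (*-congˡ (trans (z≈ B) (twoPoint-at₂ A≢B))) ⟩
    α * α + β * β ∎

  norm-e+e : ∀ {A B} → A ≢ B → N (e+e A B) ≈ 1# + 1#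
  norm-e+e A≢B = trans (norm-twoPoint A≢B refl (λ _ → refl)) (+-cong (*-identityˡ 1#) (*-identityˡ 1#))

  whenᵇ≈*if : ∀ b x → whenᵇ b x ≈ x * (if b then 1# else 0#)
  whenᵇ≈*if true  x = sym (*-identityʳ x)
  whenᵇ≈*if false x = sym (zeroʳ x)

  -- γ W X Y is the coefficient of e_W in e_X e_Y for X ≢ Y.
  γ : Point → Point → Point → Carrier
  γ W X Y = whenᵇ (isSumᵇ X Y W) (sign (ε X Y))

  γ-sum : ∀ {X Y T} → IsSum X Y T → ∀ W → γ W X Y ≈ sign (ε X Y) * δ T W
  γ-sum {X} {Y} {T} T-sum W rewrite isSumᵇ≡≟ T-sum W = whenᵇ≈*if ⌊ W ≟ T ⌋ (sign (ε X Y))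

  re-pure·pure : ∀ a b → Oct.re (pure a · pure b) ≈ - Σ₇ (λ X → a X * b X)
  re-pure·pure a b = trans (+-congʳ (zeroˡ 0#)) (+-identityˡ _)

  im-pure·pure : ∀ a b W → Oct.im (pure a · pure b) W ≈ Σ₇ (λ X → a X * Σ₇ (λ Y → b Y * γ W X Y))
  im-pure·pure a b W = begin
    0# * b W + a W * 0# + Σ₇ (λ X → Σ₇ (λ Y → whenᵇ (isSumᵇ X Y W) (sign (ε X Y) * (a X * b Y))))
      ≈⟨ +-cong (trans (+-cong (zeroˡ (b W)) (zeroʳ (a W))) (+-identityˡ 0#))
                (sum-cong-≋ λ X → sum-cong-≋ λ Y → term X Y) ⟩
    0# + Σ₇ (λ X → Σ₇ (λ Y → a X * (b Y * γ W X Y)))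
      ≈⟨ +-identityˡ _ ⟩
    Σ₇ (λ X → Σ₇ (λ Y → a X * (b Y * γ W X Y)))
      ≈⟨ sum-cong-≋ (λ X → sym (*-distribˡ-sum (a X) (λ Y → b Y * γ W X Y))) ⟩
    Σ₇ (λ X → a X * Σ₇ (λ Y → b Y * γ W X Y)) ∎
    where
    term : ∀ X Y → whenᵇ (isSumᵇ X Y W) (sign (ε X Y) * (a X * b Y)) ≈ a X * (b Y * γ W X Y)
    term X Y = begin
      whenᵇ isXY (s * (a X * b Y))          ≈⟨ whenᵇ≈*if isXY _ ⟩
      s * (a X * b Y) * [isXY]              ≈⟨ solve 4 (λ s x y w → s :* (x :* y) :* w := x :* (y :* (s :* w)))
                                                       refl s (a X) (b Y) [isXY] ⟩
      a X * (b Y * (s * [isXY]))            ≈⟨ *-congˡ (*-congˡ (sym (whenᵇ≈*if isXY s))) ⟩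
      a X * (b Y * γ W X Y)                 ∎
      where
      isXY : Bool
      isXY = isSumᵇ X Y W
      [isXY] s : Carrier
      [isXY] = if isXY then 1# else 0#
      s = sign (ε X Y)

  module _ {P Q R S T U} (PQ-sum : IsSum P Q T) (RS-sum : IsSum R S T)
                         (PS-sum : IsSum P S U) (RQ-sum : IsSum R Q U) where

    re-e+e·e+e : Oct.re (e+e P R · e+e Q S) ≈ 0#
    re-e+e·e+e = begin
      Oct.re (e+e P R · e+e Q S) ≈⟨ re-pure·pure (twoPoint 1# P 1# R) b ⟩
      - Σ₇ (λ X → twoPoint 1# P 1# R X * b X)
                                 ≈⟨ -‿cong (sum-twoPoint 1# P 1# R b) ⟩
      - (1# * b P + 1# * b R)    ≈⟨ -‿cong (+-cong (*-congˡ (twoPoint-off (proj₁ PQ-sum) (proj₁ PS-sum)))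
                                                   (*-congˡ (twoPoint-off (proj₁ RQ-sum) (proj₁ RS-sum)))) ⟩
      - (1# * 0# + 1# * 0#)      ≈⟨ -‿cong (trans (+-cong (zeroʳ 1#) (zeroʳ 1#)) (+-identityʳ 0#)) ⟩
      - 0#                       ≈⟨ -0#≈0# ⟩
      0#                         ∎
      where
      b : Point → Carrier
      b = twoPoint 1# Q 1# S

    im-e+e·e+e : ∀ W → Oct.im (e+e P R · e+e Q S) W ≈
                       twoPoint (sign (ε P Q) + sign (ε R S)) T (sign (ε P S) + sign (ε R Q)) U W
    im-e+e·e+e W = begin
      Oct.im (e+e P R · e+e Q S) W
        ≈⟨ im-pure·pure (twoPoint 1# P 1# R) b W ⟩
      Σ₇ (λ X → twoPoint 1# P 1# R X * Σ₇ (λ Y → b Y * γ W X Y))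
        ≈⟨ sum-twoPoint 1# P 1# R (λ X → Σ₇ (λ Y → b Y * γ W X Y)) ⟩
      1# * Σ₇ (λ Y → b Y * γ W P Y) + 1# * Σ₇ (λ Y → b Y * γ W R Y)
        ≈⟨ +-cong (*-congˡ (sum-twoPoint 1# Q 1# S (γ W P))) (*-congˡ (sum-twoPoint 1# Q 1# S (γ W R))) ⟩
      1# * (1# * γ W P Q + 1# * γ W P S) + 1# * (1# * γ W R Q + 1# * γ W R S)
        ≈⟨ +-cong (*-congˡ (+-cong (*-congˡ (γ-sum PQ-sum W)) (*-congˡ (γ-sum PS-sum W))))
                  (*-congˡ (+-cong (*-congˡ (γ-sum RQ-sum W)) (*-congˡ (γ-sum RS-sum W)))) ⟩
      1# * (1# * (εPQ * t) + 1# * (εPS * u)) + 1# * (1# * (εRQ * u) + 1# * (εRS * t))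
        ≈⟨ solve 6 (λ a b c d t u → con 1 :* (con 1 :* (a :* t) :+ con 1 :* (b :* u)) :+
                                     con 1 :* (con 1 :* (c :* u) :+ con 1 :* (d :* t))
                                     := (a :+ d) :* t :+ (b :+ c) :* u)
                   refl εPQ εPS εRQ εRS t u ⟩
      (εPQ + εRS) * t + (εPS + εRQ) * u ∎
      where
      b : Point → Carrier
      b = twoPoint 1# Q 1# S
      εPQ εPS εRQ εRS t u : Carrier
      εPQ = sign (ε P Q)
      εPS = sign (ε P S)
      εRQ = sign (ε R Q)
      εRS = sign (ε R S)
      t = δ T W
      u = δ U W

    norm-e+e·e+e : T ≢ U → N (e+e P R · e+e Q S) ≈
                   (sign (ε P Q) + sign (ε R S)) * (sign (ε P Q) + sign (ε R S)) +
                   (sign (ε P S) + sign (ε R Q)) * (sign (ε P S) + sign (ε R Q))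
    norm-e+e·e+e T≢U = norm-twoPoint T≢U re-e+e·e+e im-e+e·e+e

  -- Both sides equal 2 + 2·sign(a b).
  sign-sum-square : ∀ a b → (sign a + sign b) * (sign a + sign b) ≈
                           (1# + sign (a *ˢ b)) * (1# + sign (a *ˢ b))
  sign-sum-square Sign.+ Sign.+ = refl
  sign-sum-square Sign.+ Sign.- = refl
  sign-sum-square Sign.- Sign.+ = *-cong (+-comm (- 1#) 1#) (+-comm (- 1#) 1#)
  sign-sum-square Sign.- Sign.- = begin
    (- 1# + - 1#) * (- 1# + - 1#) ≈⟨ *-cong (-‿+-comm 1# 1#) (-‿+-comm 1# 1#) ⟩
    - (1# + 1#) * - (1# + 1#)     ≈⟨ -‿distribˡ-* _ _ ⟨
    - ((1# + 1#) * - (1# + 1#))   ≈⟨ -‿cong (-‿distribʳ-* _ _) ⟨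
    - - ((1# + 1#) * (1# + 1#))   ≈⟨ -‿involutive _ ⟩
    (1# + 1#) * (1# + 1#)         ∎

  module _ (isField : IsFieldCharNot2 K) where
    open FieldProperties K isField using ([1+1]*[1+1]≉0)

    shifted-sign-squares≈4⇒opposite : ∀ u v →
      (1# + sign u) * (1# + sign u) + (1# + sign v) * (1# + sign v) ≈ (1# + 1#) * (1# + 1#) →
      u ≡ opposite v
    shifted-sign-squares≈4⇒opposite Sign.+ Sign.+ eq = contradiction (x+x≈x⇒x≈0 _ eq) [1+1]*[1+1]≉0
    shifted-sign-squares≈4⇒opposite Sign.+ Sign.- _  = ≡.refl
    shifted-sign-squares≈4⇒opposite Sign.- Sign.+ _  = ≡.refl
    shifted-sign-squares≈4⇒opposite Sign.- Sign.- eq = contradiction (trans (sym eq) vanishes) [1+1]*[1+1]≉0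
      where
      vanishes : (1# + - 1#) * (1# + - 1#) + (1# + - 1#) * (1# + - 1#) ≈ 0#
      vanishes = begin
        (1# + - 1#) * (1# + - 1#) + (1# + - 1#) * (1# + - 1#)
          ≈⟨ +-cong (*-congʳ (-‿inverseʳ 1#)) (*-congʳ (-‿inverseʳ 1#)) ⟩
        0# * (1# + - 1#) + 0# * (1# + - 1#) ≈⟨ +-cong (zeroˡ _) (zeroˡ _) ⟩
        0# + 0#                              ≈⟨ +-identityʳ 0# ⟩
        0#                                   ∎

    sign-sum-squares≈4⇒opposite : ∀ a b c d →
      (sign a + sign b) * (sign a + sign b) + (sign c + sign d) * (sign c + sign d) ≈ (1# + 1#) * (1# + 1#) →
      a *ˢ b ≡ opposite (c *ˢ d)
    sign-sum-squares≈4⇒opposite a b c d eq =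
      shifted-sign-squares≈4⇒opposite (a *ˢ b) (c *ˢ d)
        (trans (sym (+-cong (sign-sum-square a b) (sign-sum-square c d))) eq)

    ε-quadrilateral : IsCompositionFactor → ∀ {P Q R S} → Quadrilateral P Q R S →
                      ε P Q *ˢ ε R S ≡ opposite (ε P S *ˢ ε R Q)
    ε-quadrilateral composition {P} {Q} {R} {S} quad@((_ , P≢R , _ , _ , Q≢S , _) , _)
      with quadrilateral-diagonal-points quad
    ... | T , U , (PQ-sum , RS-sum) , (PS-sum , RQ-sum) , T≢U =
      sign-sum-squares≈4⇒opposite (ε P Q) (ε R S) (ε P S) (ε R Q) (begin
        _                         ≈⟨ norm-e+e·e+e PQ-sum RS-sum PS-sum RQ-sum T≢U ⟨
        N (e+e P R · e+e Q S)     ≈⟨ composition (e+e P R) (e+e Q S) ⟩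
        N (e+e P R) * N (e+e Q S) ≈⟨ *-cong (norm-e+e P≢R) (norm-e+e Q≢S) ⟩
        (1# + 1#) * (1# + 1#)     ∎)

    ε-around-quadrilateral : IsCompositionFactor → ∀ {P Q R S} → Quadrilateral P Q R S →
                             ε P Q *ˢ ε Q R ≡ opposite (ε P S *ˢ ε S R)
    ε-around-quadrilateral composition {P} {Q} {R} {S} quad@((_ , _ , _ , Q≢R , _ , R≢S) , _) =
      swap-opposite-factors (ε P Q) (ε Q R) (ε P S) (ε S R)
        (≡.subst₂ (λ x y → ε P Q *ˢ x ≡ opposite (ε P S *ˢ y))
                  (ε-anti S R (≢-sym R≢S)) (ε-anti Q R Q≢R) (ε-quadrilateral composition quad))

proposition2p28 : {c ℓ : Level} (K : CommutativeRing c ℓ) → IsFieldCharNot2 K →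
    (𝓕 : FanoPlane) (ε : MultFactor 𝓕) → Octonions.IsCompositionFactor K 𝓕 ε →
    (g : Point → Point) → FanoPlane.IsAut 𝓕 g →
    (P Q R S : Point) → FanoPlane.Quadrilateral 𝓕 P Q R S →
    δ* ε g P Q *ˢ δ* ε g Q R ≡ δ* ε g P S *ˢ δ* ε g S R
proposition2p28 K isField 𝓕 mf composition g g-aut P Q R S quad = begin
  (a *ˢ a′) *ˢ (b *ˢ b′)                             ≡⟨ interchange a a′ b b′ ⟩
  (a *ˢ b) *ˢ (a′ *ˢ b′)                             ≡⟨ ≡.cong₂ _*ˢ_ (around quad) (around g-quad) ⟩
  opposite (c *ˢ d) *ˢ opposite (c′ *ˢ d′) ≡⟨ interchange Sign.- (c *ˢ d) Sign.- (c′ *ˢ d′) ⟩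
  (c *ˢ d) *ˢ (c′ *ˢ d′)                             ≡⟨ interchange c d c′ d′ ⟩
  (c *ˢ c′) *ˢ (d *ˢ d′)                             ∎
  where
  open ≡.≡-Reasoning
  open MultFactor mf
  open FanoPlane 𝓕 using (Quadrilateral)
  open FanoGeometry 𝓕 using (aut-preserves-quadrilateral)
  open OctonionNorms K 𝓕 mf using (ε-around-quadrilateral)
  around : ∀ {P Q R S} → Quadrilateral P Q R S → ε P Q *ˢ ε Q R ≡ opposite (ε P S *ˢ ε S R)
  around = ε-around-quadrilateral isField composition
  g-quad : Quadrilateral (g P) (g Q) (g R) (g S)
  g-quad = aut-preserves-quadrilateral g-aut quad
  a b c d a′ b′ c′ d′ : Sign
  a = ε P Q
  b = ε Q R
  c = ε P S
  d = ε S R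
  a′ = ε (g P) (g Q)
  b′ = ε (g Q) (g R)
  c′ = ε (g P) (g S)
  d′ = ε (g S) (g R)
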